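{- Let $w$ be an infinite ternary square-free word and let $x\in\{a,b,c\}$ be a letter. Then the lower and upper frequencies $f^-$ and $f^+$ of $x$ in $w$ satisfy $$\frac{31}{117}\;\le\; f^-\;\le\; f^+\;\le\;\frac{39}{97}.$$
   Context: Words are strings over the alphabet $\{a,b,c\}$. A (finite or infinite) word $w$ is square-free if it contains no factor of the form $yy$ with $y$ a nonempty finite word. For an infinite word $w$ and a letter $x$, let $x_n^{+}$ (resp. $x_n^{ - }$) be the maximum (resp. minimum) number of occurrences of $x$ in a length-$n$ factor (contiguous subword) of $w$. The upper and lower frequencies of $x$ in $w$ are $f^{\pm}=\lim_{n\to\infty}x_n^{\pm}/n$ (these limits exist). -}

module Defs where

open import Data.Nat using (ℕ; zero; suc; _+_; _*_; _≤_; _<_)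
open import Data.Product using (Σ; _×_; ∃)
open import Relation.Binary.PropositionalEquality using (_≡_; refl)
open import Relation.Nullary using (¬_; Dec; yes; no)

data Letter : Set where
  a b c : Letter

_≟L_ : (x y : Letter) → Dec (x ≡ y)
a ≟L a = yes refl
a ≟L b = no λ ()
a ≟L c = no λ ()
b ≟L a = no λ ()
b ≟L b = yes refl
b ≟L c = no λ ()
c ≟L a = no λ ()
c ≟L b = no λ ()
c ≟L c = yes refl

InfWord : Set
InfWord = ℕ → Letter

HasSquareAt : InfWord → ℕ → ℕ → Set
HasSquareAt w i l = (j : ℕ) → j < l → w (i + j) ≡ w (i + l + j)

SquareFree : InfWord → Set
SquareFree w = ¬ (Σ ℕ λ i → Σ ℕ λ l → 1 ≤ l × HasSquareAt w i l)

count : InfWord → Letter → ℕ → ℕ → ℕ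
count w x i zero = 0
count w x i (suc n) with w i ≟L x
... | yes _ = suc (count w x (suc i) n)
... | no  _ = count w x (suc i) n

-- f⁻ ≥ p/q, where f⁻ = lim x⁻ₙ/n and x⁻ₙ = min over i of count w x i n:
-- for every k ≥ 1 there is N with x⁻ₙ/n ≥ p/q - 1/(qk) for all n ≥ N,
-- i.e. every length-n factor (n ≥ N) satisfies q·k·count + n ≥ p·k·n.
LowerFreq≥ : InfWord → Letter → ℕ → ℕ → Set
LowerFreq≥ w x p q = (k : ℕ) → 1 ≤ k → Σ ℕ λ N → (n : ℕ) → N ≤ n → (i : ℕ) →
  p * k * n ≤ q * k * count w x i n + n

-- f⁺ ≤ p/q, where f⁺ = lim x⁺ₙ/n and x⁺ₙ = max over i of count w x i n:
-- for every k ≥ 1 there is N with x⁺ₙ/n ≤ p/q + 1/(qk) for all n ≥ N.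
UpperFreq≤ : InfWord → Letter → ℕ → ℕ → Set
UpperFreq≤ w x p q = (k : ℕ) → 1 ≤ k → Σ ℕ λ N → (n : ℕ) → N ≤ n → (i : ℕ) →
  q * k * count w x i n ≤ p * k * n + n

-- Every factor of length 30 of a square-free ternary word contains each letter at least 8
-- and at most 12 times; this is checked by a search over all square-free words of length 30,
-- pruned as soon as a square appears. Cutting a long factor into blocks of length 30 gives
-- 8/30 ≤ f⁻ and f⁺ ≤ 12/30, and 31/117 < 8/30, 12/30 < 39/97.

module Submission where

open import Defs
open import Data.Bool using (Bool; true; false; T; _∧_; _∨_)
open import Data.Bool.Properties using (T-∧; T-∨; T-≡)
open import Data.Empty using (⊥-elim)
open import Data.List using (List; []; _∷_; length; take; drop; filter)
open import Data.List.Properties using (∷-injectiveˡ; ∷-injectiveʳ; drop-drop)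
open import Data.Nat using (ℕ; zero; suc; _+_; _*_; _∸_; _≤_; _<_; _≤ᵇ_; z≤n; s≤s; NonZero; _/_; _%_)
open import Data.Nat.DivMod using (m≡m%n+[m/n]*n; m%n<n; m*n/n≡m; /-monoˡ-≤)
open import Data.Nat.Properties
open import Algebra.Properties.CommutativeSemigroup *-commutativeSemigroup
  using (x∙yz≈y∙xz; xy∙z≈y∙xz)
open import Data.Product using (_×_; _,_; proj₁; proj₂; ∃-syntax)
open import Data.Sum using (inj₁; inj₂)
open import Function using (_∘_; Equivalence)
open import Relation.Binary.Definitions using (DecidableEquality)
open import Relation.Binary.PropositionalEquality
open import Relation.Nullary using (yes; no)
open import Relation.Nullary.Decidable using (⌊_⌋; toWitness)

open Equivalence using (to; from)

module _ {A : Set} (_≟_ : DecidableEquality A) where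

  prefixesAgree : ℕ → List A → List A → Bool
  prefixesAgree zero    _        _        = true
  prefixesAgree (suc n) (x ∷ xs) (y ∷ ys) = ⌊ x ≟ y ⌋ ∧ prefixesAgree n xs ys
  prefixesAgree (suc n) _        _        = false

  prefixesAgree-sound : ∀ n xs ys → T (prefixesAgree n xs ys) →
                        take n xs ≡ take n ys × n ≤ length ys
  prefixesAgree-sound zero    xs       ys       _ = refl , z≤n
  prefixesAgree-sound (suc n) (x ∷ xs) (y ∷ ys) h =
    let x≡y , agree = to (T-∧ {⌊ x ≟ y ⌋}) h
        xs≡ys , n≤ = prefixesAgree-sound n xs ys agree
    in cong₂ _∷_ (toWitness {a? = x ≟ y} x≡y) xs≡ys , s≤s n≤

  -- The last argument caches drop p xs, so that each half-length p is tried in time O(p).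
  squarePrefixFrom : ℕ → List A → List A → Bool
  squarePrefixFrom p xs []       = false
  squarePrefixFrom p xs (y ∷ ys) = prefixesAgree p xs (y ∷ ys) ∨ squarePrefixFrom (suc p) xs ys

  squarePrefixFrom-sound : ∀ p xs ys → drop p xs ≡ ys → T (squarePrefixFrom p xs ys) →
                           ∃[ q ] p ≤ q × T (prefixesAgree q xs (drop q xs))
  squarePrefixFrom-sound p xs (y ∷ ys) eq h with to (T-∨ {prefixesAgree p xs (y ∷ ys)}) h
  ... | inj₁ agree = p , ≤-refl , subst (T ∘ prefixesAgree p xs) (sym eq) agree
  ... | inj₂ later =
    let q , p<q , agree = squarePrefixFrom-sound (suc p) xs ys drop-suc later
    in q , ≤-trans (n≤1+n p) p<q , agree
    where
    open ≡-Reasoning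
    drop-suc : drop (suc p) xs ≡ ys
    drop-suc = begin
      drop (suc p) xs     ≡⟨ cong (λ k → drop k xs) (+-comm 1 p) ⟩
      drop (p + 1) xs     ≡⟨ drop-drop p 1 xs ⟨
      drop 1 (drop p xs)  ≡⟨ cong (drop 1) eq ⟩
      ys                  ∎

  hasSquarePrefix : List A → Bool
  hasSquarePrefix xs = squarePrefixFrom 1 xs (drop 1 xs)

  hasSquarePrefix-sound : ∀ xs → T (hasSquarePrefix xs) →
    ∃[ p ] 1 ≤ p × take p xs ≡ take p (drop p xs) × p ≤ length (drop p xs)
  hasSquarePrefix-sound xs h =
    let p , 1≤p , agree = squarePrefixFrom-sound 1 xs (drop 1 xs) refl h
    in p , 1≤p , prefixesAgree-sound p xs (drop p xs) agree

factor : InfWord → ℕ → ℕ → List Letter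
factor w i zero    = []
factor w i (suc n) = w i ∷ factor w (suc i) n

length-factor : ∀ w i n → length (factor w i n) ≡ n
length-factor w i zero    = refl
length-factor w i (suc n) = cong suc (length-factor w (suc i) n)

take-factor : ∀ w i {m n} → m ≤ n → take m (factor w i n) ≡ factor w i m
take-factor w i {zero}  _         = refl
take-factor w i {suc m} (s≤s m≤n) = cong (w i ∷_) (take-factor w (suc i) m≤n)

drop-factor : ∀ w i m n → drop m (factor w i n) ≡ factor w (i + m) (n ∸ m)
drop-factor w i zero    n       rewrite +-identityʳ i = refl
drop-factor w i (suc m) zero    = refl
drop-factor w i (suc m) (suc n) rewrite +-suc i m = drop-factor w (suc i) m n

factor≡⇒letters≡ : ∀ w i j l → factor w i l ≡ factor w j l → ∀ k → k < l → w (i + k) ≡ w (j + k)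
factor≡⇒letters≡ w i j (suc l) eq zero    _
  rewrite +-identityʳ i | +-identityʳ j = ∷-injectiveˡ eq
factor≡⇒letters≡ w i j (suc l) eq (suc k) (s≤s k<l)
  rewrite +-suc i k | +-suc j k = factor≡⇒letters≡ w (suc i) (suc j) l (∷-injectiveʳ eq) k k<l

halves-of-factor : ∀ w i m p → take p (factor w i m) ≡ take p (drop p (factor w i m)) →
                   p ≤ length (drop p (factor w i m)) → factor w i p ≡ factor w (i + p) p
halves-of-factor w i m p prefix≡ p≤rest = begin
  factor w i p                      ≡⟨ take-factor w i (≤-trans p≤m∸p (m∸n≤m m p)) ⟨
  take p (factor w i m)             ≡⟨ prefix≡ ⟩
  take p (drop p (factor w i m))    ≡⟨ cong (take p) (drop-factor w i p m) ⟩
  take p (factor w (i + p) (m ∸ p)) ≡⟨ take-factor w (i + p) p≤m∸p ⟩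
  factor w (i + p) p                ∎
  where
  open ≡-Reasoning
  p≤m∸p : p ≤ m ∸ p
  p≤m∸p = subst (p ≤_) (trans (cong length (drop-factor w i p m)) (length-factor w (i + p) (m ∸ p)))
                p≤rest

squarePrefix⇒square : ∀ w i m → T (hasSquarePrefix _≟L_ (factor w i m)) →
                      ∃[ l ] 1 ≤ l × HasSquareAt w i l
squarePrefix⇒square w i m h =
  let p , 1≤p , prefix≡ , p≤rest = hasSquarePrefix-sound _≟L_ (factor w i m) h
  in p , 1≤p , factor≡⇒letters≡ w i (i + p) p (halves-of-factor w i m p prefix≡ p≤rest)

allLetters : (Letter → Bool) → Bool
allLetters f = f a ∧ f b ∧ f c

allLetters-elim : ∀ f → T (allLetters f) → ∀ x → T (f x)
allLetters-elim f h =
  let fa , fbc = to (T-∧ {f a}) h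
      fb , fc  = to (T-∧ {f b}) fbc
  in λ where
       a → fa
       b → fb
       c → fc

-- Checks g on every word obtained from u by prepending r letters without ever creating a
-- square prefix; for square-free u these are exactly the square-free such words.
allSquareFreeExtensions : (List Letter → Bool) → ℕ → List Letter → Bool
allSquareFreeExtensions g zero    u = g u
allSquareFreeExtensions g (suc r) u =
  allLetters λ x → hasSquarePrefix _≟L_ (x ∷ u) ∨ allSquareFreeExtensions g r (x ∷ u)

allSquareFreeExtensions-sound : ∀ {w} → SquareFree w → ∀ g r i m →
  T (allSquareFreeExtensions g r (factor w (r + i) m)) → T (g (factor w i (r + m)))
allSquareFreeExtensions-sound sf g zero i m h = h
allSquareFreeExtensions-sound {w} sf g (suc r) i m h =
  subst (T ∘ g ∘ factor w i) (+-suc r m) (allSquareFreeExtensions-sound sf g r i (suc m) extended)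
  where
  u = factor w (suc r + i) m
  extended : T (allSquareFreeExtensions g r (factor w (r + i) (suc m)))
  extended with to (T-∨ {hasSquarePrefix _≟L_ (w (r + i) ∷ u)})
                   (allLetters-elim (λ y → hasSquarePrefix _≟L_ (y ∷ u) ∨ allSquareFreeExtensions g r (y ∷ u))
                      h (w (r + i)))
  ... | inj₁ square = ⊥-elim (sf (r + i , squarePrefix⇒square w (r + i) (suc m) square))
  ... | inj₂ rest   = rest

-- The premise is ≡ true rather than T so that refl discharges it by conversion checking;
-- a premise T (…) would be normalised by Agda's much slower reducer.
squareFree⇒factorsSatisfy : ∀ {w} g r → allSquareFreeExtensions g r [] ≡ true →
                            SquareFree w → ∀ i → T (g (factor w i r))
squareFree⇒factorsSatisfy {w} g r h sf i =
  subst (T ∘ g ∘ factor w i) (+-identityʳ r)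
    (allSquareFreeExtensions-sound sf g r i 0 (from T-≡ h))

occurrences : Letter → List Letter → ℕ
occurrences x u = length (filter (_≟L x) u)

count-factor : ∀ w x i n → count w x i n ≡ occurrences x (factor w i n)
count-factor w x i zero = refl
count-factor w x i (suc n) with w i ≟L x
... | yes _ = cong suc (count-factor w x (suc i) n)
... | no  _ = count-factor w x (suc i) n

count-++ : ∀ w x i m n → count w x i (m + n) ≡ count w x i m + count w x (i + m) n
count-++ w x i zero    n rewrite +-identityʳ i = refl
count-++ w x i (suc m) n rewrite +-suc i m with w i ≟L x
... | yes _ = cong suc (count-++ w x (suc i) m n)
... | no  _ = count-++ w x (suc i) m n

count≤length : ∀ w x i n → count w x i n ≤ n
count≤length w x i zero = z≤n
count≤length w x i (suc n) with w i ≟L x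
... | yes _ = s≤s (count≤length w x (suc i) n)
... | no  _ = m≤n⇒m≤1+n (count≤length w x (suc i) n)

count-*-≥ : ∀ {w x L k} → (∀ i → k ≤ count w x i L) → ∀ Q i → Q * k ≤ count w x i (Q * L)
count-*-≥         block zero    i = z≤n
count-*-≥ {w} {x} {L} block (suc Q) i =
  subst (suc Q * _ ≤_) (sym (count-++ w x i L (Q * L)))
    (+-mono-≤ (block i) (count-*-≥ block Q (i + L)))

count-*-≤ : ∀ {w x L k} → (∀ i → count w x i L ≤ k) → ∀ Q i → count w x i (Q * L) ≤ Q * k
count-*-≤         block zero    i = z≤n
count-*-≤ {w} {x} {L} block (suc Q) i =
  subst (_≤ suc Q * _) (sym (count-++ w x i L (Q * L)))
    (+-mono-≤ (block i) (count-*-≤ block Q (i + L)))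

module _ {L : ℕ} .{{_ : NonZero L}} where

  n≡n/L*L+n%L : ∀ n → n ≡ n / L * L + n % L
  n≡n/L*L+n%L n = trans (m≡m%n+[m/n]*n n L) (+-comm (n % L) _)

  m*[n%L]≤n/L : ∀ m n → m * L * L ≤ n → m * (n % L) ≤ n / L
  m*[n%L]≤n/L m n mLL≤n = begin
    m * (n % L)   ≤⟨ *-monoʳ-≤ m (<⇒≤ (m%n<n n L)) ⟩
    m * L         ≡⟨ m*n/n≡m (m * L) L ⟨
    m * L * L / L ≤⟨ /-monoˡ-≤ L mLL≤n ⟩
    n / L         ∎
    where open ≤-Reasoning

*-distrib-blocks : ∀ m Q L r → m * (Q * L + r) ≡ Q * (m * L) + m * r
*-distrib-blocks m Q L r = trans (*-distribˡ-+ m (Q * L) r) (cong (_+ m * r) (x∙yz≈y∙xz m Q L))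

LowerFreq≥-intro : ∀ {w x p q} N → (∀ n → N ≤ n → ∀ i → p * n ≤ q * count w x i n) →
                   LowerFreq≥ w x p q
LowerFreq≥-intro {w} {x} {p} {q} N bound k _ = N , λ n N≤n i → begin
  p * k * n                   ≡⟨ xy∙z≈y∙xz p k n ⟩
  k * (p * n)                 ≤⟨ *-monoʳ-≤ k (bound n N≤n i) ⟩
  k * (q * count w x i n)     ≡⟨ xy∙z≈y∙xz q k _ ⟨
  q * k * count w x i n       ≤⟨ m≤m+n _ n ⟩
  q * k * count w x i n + n   ∎
  where open ≤-Reasoning

UpperFreq≤-intro : ∀ {w x p q} N → (∀ n → N ≤ n → ∀ i → q * count w x i n ≤ p * n) →
                   UpperFreq≤ w x p q
UpperFreq≤-intro {w} {x} {p} {q} N bound k _ = N , λ n N≤n i → begin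
  q * k * count w x i n       ≡⟨ xy∙z≈y∙xz q k _ ⟩
  k * (q * count w x i n)     ≤⟨ *-monoʳ-≤ k (bound n N≤n i) ⟩
  k * (p * n)                 ≡⟨ xy∙z≈y∙xz p k n ⟨
  p * k * n                   ≤⟨ m≤m+n _ n ⟩
  p * k * n + n               ∎
  where open ≤-Reasoning

-- N = pL² makes n / L ≥ pL, enough to absorb the incomplete last block.
lowerFreq≥-from-blocks : ∀ {w x p q L k} .{{_ : NonZero L}} →
  (∀ i → k ≤ count w x i L) → p * L < q * k → LowerFreq≥ w x p q
lowerFreq≥-from-blocks {w} {x} {p} {q} {L} {k} block gap =
  LowerFreq≥-intro {w} {x} {p} {q} (p * L * L) bound
  where
  bound : ∀ n → p * L * L ≤ n → ∀ i → p * n ≤ q * count w x i n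
  bound n pLL≤n i = begin
    p * n                        ≡⟨ cong (p *_) n≡ ⟩
    p * (Q * L + r)              ≡⟨ *-distrib-blocks p Q L r ⟩
    Q * (p * L) + p * r          ≤⟨ +-monoʳ-≤ (Q * (p * L)) (m*[n%L]≤n/L p n pLL≤n) ⟩
    Q * (p * L) + Q              ≡⟨ trans (*-suc Q (p * L)) (+-comm Q _) ⟨
    Q * suc (p * L)              ≤⟨ *-monoʳ-≤ Q gap ⟩
    Q * (q * k)                  ≡⟨ x∙yz≈y∙xz Q q k ⟩
    q * (Q * k)                  ≤⟨ *-monoʳ-≤ q blocks ⟩
    q * count w x i n            ∎
    where
    open ≤-Reasoning
    Q = n / L
    r = n % L
    n≡ = n≡n/L*L+n%L n
    blocks : Q * k ≤ count w x i n
    blocks = begin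
      Q * k                                              ≤⟨ count-*-≥ block Q i ⟩
      count w x i (Q * L)                                ≤⟨ m≤m+n _ _ ⟩
      count w x i (Q * L) + count w x (i + Q * L) r      ≡⟨ count-++ w x i (Q * L) r ⟨
      count w x i (Q * L + r)                            ≡⟨ cong (count w x i) n≡ ⟨
      count w x i n                                      ∎

upperFreq≤-from-blocks : ∀ {w x p q L k} .{{_ : NonZero L}} →
  (∀ i → count w x i L ≤ k) → q * k < p * L → UpperFreq≤ w x p q
upperFreq≤-from-blocks {w} {x} {p} {q} {L} {k} block gap =
  UpperFreq≤-intro {w} {x} {p} {q} (q * L * L) bound
  where
  bound : ∀ n → q * L * L ≤ n → ∀ i → q * count w x i n ≤ p * n
  bound n qLL≤n i = begin
    q * count w x i n            ≤⟨ *-monoʳ-≤ q blocks ⟩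
    q * (Q * k + r)              ≡⟨ *-distrib-blocks q Q k r ⟩
    Q * (q * k) + q * r          ≤⟨ +-monoʳ-≤ (Q * (q * k)) (m*[n%L]≤n/L q n qLL≤n) ⟩
    Q * (q * k) + Q              ≡⟨ trans (*-suc Q (q * k)) (+-comm Q _) ⟨
    Q * suc (q * k)              ≤⟨ *-monoʳ-≤ Q gap ⟩
    Q * (p * L)                  ≤⟨ m≤m+n _ (p * r) ⟩
    Q * (p * L) + p * r          ≡⟨ *-distrib-blocks p Q L r ⟨
    p * (Q * L + r)              ≡⟨ cong (p *_) n≡ ⟨
    p * n                        ∎
    where
    open ≤-Reasoning
    Q = n / L
    r = n % L
    n≡ = n≡n/L*L+n%L n
    blocks : count w x i n ≤ Q * k + r
    blocks = begin
      count w x i n                                      ≡⟨ cong (count w x i) n≡ ⟩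
      count w x i (Q * L + r)                            ≡⟨ count-++ w x i (Q * L) r ⟩
      count w x i (Q * L) + count w x (i + Q * L) r
        ≤⟨ +-mono-≤ (count-*-≤ block Q i) (count≤length w x (i + Q * L) r) ⟩
      Q * k + r                                          ∎

occurrencesBetween : ℕ → ℕ → List Letter → Bool
occurrencesBetween lo hi u = allLetters λ x → (lo ≤ᵇ occurrences x u) ∧ (occurrences x u ≤ᵇ hi)

squareFreeWords30-occurrences : allSquareFreeExtensions (occurrencesBetween 8 12) 30 [] ≡ true
squareFreeWords30-occurrences = refl

squareFree⇒count30 : ∀ {w} → SquareFree w → ∀ x i → 8 ≤ count w x i 30 × count w x i 30 ≤ 12
squareFree⇒count30 {w} sf x i =
  let u = factor w i 30
      k = occurrences x u
      lo , hi = to (T-∧ {8 ≤ᵇ k} {k ≤ᵇ 12})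
                   (allLetters-elim (λ y → (8 ≤ᵇ occurrences y u) ∧ (occurrences y u ≤ᵇ 12))
                     (squareFree⇒factorsSatisfy {w} (occurrencesBetween 8 12) 30
                       squareFreeWords30-occurrences sf i) x)
  in subst (λ n → 8 ≤ n × n ≤ 12) (sym (count-factor w x i 30)) (≤ᵇ⇒≤ 8 k lo , ≤ᵇ⇒≤ k 12 hi)

theorem2 : (w : InfWord) → SquareFree w → (x : Letter) →
    LowerFreq≥ w x 31 117 × UpperFreq≤ w x 39 97
theorem2 w sf x =
    lowerFreq≥-from-blocks {p = 31} {q = 117} {L = 30} {k = 8}
      (proj₁ ∘ counts) (<ᵇ⇒< (31 * 30) (117 * 8) _)
  , upperFreq≤-from-blocks {p = 39} {q = 97} {L = 30} {k = 12}
      (proj₂ ∘ counts) (<ᵇ⇒< (97 * 12) (39 * 30) _)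
  where
  counts : ∀ i → 8 ≤ count w x i 30 × count w x i 30 ≤ 12
  counts = squareFree⇒count30 {w} sf x
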